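{- For every pattern $P$ on variables $x_1,\dots,x_k$ there is a conjunction $C$ of bracket predicates on $x_1,\dots,x_k$ such that for every tree $T$ and every injective assignment of $x_1,\dots,x_k$ to leaves of $T$, the variables match $P$ if and only if $C$ holds.
   Context: Trees: finite rooted trees in which every internal node has exactly two children, ordered as left and right; leaves are ordered left to right. A pattern on $x_1,\dots,x_k$ is such a tree with $k$ leaves bijectively labelled by $x_1,\dots,x_k$. Variables injectively placed at leaves of $T$ match $P$ if $P$ (with labels and left/right order) is obtained from $T$ by repeatedly deleting leaves not assigned to any $x_i$ and contracting nodes with only one child. Bracket predicates, for placed variables $a,b,c$: $[a<b]$ holds if $a$ is to the left of $b$; $[a,b<c]$ holds if $a$ and $b$ lie in the left subtree of $\mathrm{lca}(a,b,c)$ and $c$ lies in its right subtree; $[a<b,c]$ holds if $a$ lies in the left subtree of $\mathrm{lca}(a,b,c)$ and $b,c$ lie in its right subtree. -}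

module Defs where

open import Data.Nat using (ℕ; zero; suc)
open import Data.Fin using (Fin; zero; suc)
open import Data.Maybe using (Maybe; just; nothing)
import Data.Maybe as Maybe
open import Data.List using (List; []; _∷_; _++_)
open import Data.List.Relation.Unary.All using (All)
open import Data.List.Relation.Unary.Unique.Propositional using (Unique)
open import Data.List.Membership.Propositional using (_∈_)
open import Relation.Nullary using (Dec; yes; no)
open import Relation.Binary.PropositionalEquality using (_≡_; refl; cong)

data Tree : Set where
  leaf : Tree
  node : Tree → Tree → Tree

data Pos : Tree → Set where
  here  : Pos leaf
  left  : ∀ {l r} → Pos l → Pos (node l r)
  right : ∀ {l r} → Pos r → Pos (node l r)

left-inj : ∀ {l r} {p q : Pos l} → left {l} {r} p ≡ left q → p ≡ q
left-inj refl = refl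

right-inj : ∀ {l r} {p q : Pos r} → right {l} {r} p ≡ right q → p ≡ q
right-inj refl = refl

_≟P_ : ∀ {T} (p q : Pos T) → Dec (p ≡ q)
here ≟P here = yes refl
left p ≟P left q with p ≟P q
... | yes refl = yes refl
... | no ne = no (λ e → ne (left-inj e))
left p ≟P right q = no (λ ())
right p ≟P left q = no (λ ())
right p ≟P right q with p ≟P q
... | yes refl = yes refl
... | no ne = no (λ e → ne (right-inj e))

data LTree (A : Set) : Set where
  lleaf : A → LTree A
  lnode : LTree A → LTree A → LTree A

labels : ∀ {A} → LTree A → List A
labels (lleaf a) = a ∷ []
labels (lnode l r) = labels l ++ labels r

record Pattern (k : ℕ) : Set where
  constructor mkPattern
  field
    shape    : LTree (Fin k)
    distinct : Unique (labels shape)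
    covers   : ∀ (i : Fin k) → i ∈ labels shape
open Pattern public

assigned : ∀ {k T} → (Fin k → Pos T) → Pos T → Maybe (Fin k)
assigned {zero} f p = nothing
assigned {suc k} f p with f zero ≟P p
... | yes _ = just zero
... | no _ = Maybe.map suc (assigned (λ i → f (suc i)) p)

-- Delete unlabelled leaves and contract nodes with one child (repeatedly).
-- nothing = everything was deleted.
restrict : ∀ {A} (T : Tree) → (Pos T → Maybe A) → Maybe (LTree A)
restrict leaf g = Maybe.map lleaf (g here)
restrict (node l r) g with restrict l (λ p → g (left p)) | restrict r (λ p → g (right p))
... | just L  | just R  = just (lnode L R)
... | just L  | nothing = just L
... | nothing | just R  = just R
... | nothing | nothing = nothing

Matches : ∀ {k} (T : Tree) → (Fin k → Pos T) → Pattern k → Set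
Matches T f P = restrict T (assigned f) ≡ just (shape P)

data _≺_ : ∀ {T} → Pos T → Pos T → Set where
  lr : ∀ {l r} {p : Pos l} {q : Pos r} → left p ≺ right q
  ll : ∀ {l r} {p q : Pos l} → p ≺ q → left {l} {r} p ≺ left q
  rr : ∀ {l r} {p q : Pos r} → p ≺ q → right {l} {r} p ≺ right q

-- [a , b < c] : at lca(a,b,c), a and b are in the left subtree, c in the right.
data Br2<1 : ∀ {T} → Pos T → Pos T → Pos T → Set where
  split : ∀ {l r} {a b : Pos l} {c : Pos r} → Br2<1 (left a) (left b) (right c)
  goL   : ∀ {l r} {a b c : Pos l} → Br2<1 a b c → Br2<1 (left {l} {r} a) (left b) (left c)
  goR   : ∀ {l r} {a b c : Pos r} → Br2<1 a b c → Br2<1 (right {l} {r} a) (right b) (right c)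

-- [a < b , c] : at lca(a,b,c), a is in the left subtree, b and c in the right.
data Br1<2 : ∀ {T} → Pos T → Pos T → Pos T → Set where
  split : ∀ {l r} {a : Pos l} {b c : Pos r} → Br1<2 (left a) (right b) (right c)
  goL   : ∀ {l r} {a b c : Pos l} → Br1<2 a b c → Br1<2 (left {l} {r} a) (left b) (left c)
  goR   : ∀ {l r} {a b c : Pos r} → Br1<2 a b c → Br1<2 (right {l} {r} a) (right b) (right c)

data Bracket (k : ℕ) : Set where
  lt   : Fin k → Fin k → Bracket k
  lt21 : Fin k → Fin k → Fin k → Bracket k
  lt12 : Fin k → Fin k → Fin k → Bracket k

Holds : ∀ {k T} → (Fin k → Pos T) → Bracket k → Set
Holds f (lt a b) = f a ≺ f b
Holds f (lt21 a b c) = Br2<1 (f a) (f b) (f c)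
Holds f (lt12 a b c) = Br1<2 (f a) (f b) (f c)

Conj : ℕ → Set
Conj k = List (Bracket k)

HoldsAll : ∀ {k T} → (Fin k → Pos T) → Conj k → Set
HoldsAll f C = All (Holds f) C

{-# OPTIONS --safe #-}
-- C collects, for every internal node of P with subtrees A and B, the
-- brackets [a<b], [a,a'<b], [a<b,b'] with a, a' ∈ A and b, b' ∈ B.  If all variables lie in one subtree of the root, both the restriction
-- and the brackets only see that subtree.  Otherwise the restriction is
-- lnode L R for the restrictions L, R of the two subtrees, so P = lnode A B
-- matches iff the variables of A lie left and those of B right of the root
-- and A, B are matched below.  Given one variable on each side, a variable of
-- A or B on the wrong side violates one of the root's brackets.
module Submission where

open import Data.Nat using (ℕ; suc)
open import Data.Fin using (Fin; zero; suc)
open import Data.Fin.Properties using (suc-injective)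
open import Data.Product using (Σ; ∃; _×_; _,_; proj₁; proj₂)
open import Data.Sum using (_⊎_; inj₁; inj₂)
open import Data.Empty using (⊥; ⊥-elim)
open import Data.Maybe using (Maybe; just; nothing)
import Data.Maybe as Maybe
open import Data.Maybe.Properties using (just-injective)
open import Data.List using (List; []; _∷_; _++_; cartesianProductWith; cartesianProduct)
open import Data.List.Relation.Unary.Any using (here)
open import Data.List.Relation.Unary.Any.Properties using (singleton⁻)
open import Data.List.Relation.Unary.All as All using (All; []; _∷_)
open import Data.List.Relation.Unary.All.Properties using (++⁺; ++⁻; cartesianProductWith⁺)
open import Data.List.Membership.Propositional using (_∈_)
open import Data.List.Membership.Propositional.Properties
  using (∈-++⁺ˡ; ∈-++⁺ʳ; ∈-++⁻; ∈-cartesianProductWith⁺; ∈-cartesianProduct⁺; ∈-cartesianProduct⁻)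
open import Data.List.Relation.Binary.Subset.Propositional using (_⊆_)
open import Function using (Injective; _⇔_; mk⇔; Equivalence; _∘_; id)
open import Function.Construct.Composition using (_⇔-∘_)
open import Function.Construct.Symmetry using (⇔-sym)
open import Relation.Nullary using (yes; no)
open import Relation.Binary.PropositionalEquality
  using (_≡_; refl; sym; trans; cong; cong₂; subst; setoid)
open import Defs

open Equivalence using (to; from)

All-⇔ : ∀ {A : Set} {P Q : A → Set} {xs : List A} →
  All (λ x → P x ⇔ Q x) xs → All P xs ⇔ All Q xs
All-⇔ [] = mk⇔ (λ _ → []) (λ _ → [])
All-⇔ (e ∷ es) = mk⇔ (λ { (p ∷ ps) → to e p ∷ to (All-⇔ es) ps })
                     (λ { (q ∷ qs) → from e q ∷ from (All-⇔ es) qs })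

leftmost : ∀ {A} → LTree A → A
leftmost (lleaf a) = a
leftmost (lnode L R) = leftmost L

leftmost∈labels : ∀ {A} (S : LTree A) → leftmost S ∈ labels S
leftmost∈labels (lleaf a) = here refl
leftmost∈labels (lnode L R) = ∈-++⁺ˡ (leftmost∈labels L)

data IsLeft {l r : Tree} : Pos (node l r) → Set where
  isLeft : (p : Pos l) → IsLeft (left p)

data IsRight {l r : Tree} : Pos (node l r) → Set where
  isRight : (p : Pos r) → IsRight (right p)

side : ∀ {l r} (p : Pos (node l r)) → IsLeft p ⊎ IsRight p
side (left p) = inj₁ (isLeft p)
side (right p) = inj₂ (isRight p)

IsLeft∧IsRight⇒⊥ : ∀ {l r} {p : Pos (node l r)} → IsLeft p → IsRight p → ⊥
IsLeft∧IsRight⇒⊥ (isLeft _) ()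

leaf-pos : (p : Pos leaf) → p ≡ here
leaf-pos here = refl

somePos : (T : Tree) → Pos T
somePos leaf = here
somePos (node l r) = left (somePos l)

-- unLeft/unRight return a junk position on the other side; they are only
-- relied upon at positions satisfying IsLeft/IsRight.
unLeft : ∀ {l r} → Pos (node l r) → Pos l
unLeft (left p) = p
unLeft {l} (right _) = somePos l

unRight : ∀ {l r} → Pos (node l r) → Pos r
unRight (right p) = p
unRight {r = r} (left _) = somePos r

IsLeft⇒≡left : ∀ {l r} {p : Pos (node l r)} → IsLeft p → p ≡ left (unLeft p)
IsLeft⇒≡left (isLeft _) = refl

IsRight⇒≡right : ∀ {l r} {p : Pos (node l r)} → IsRight p → p ≡ right (unRight p)
IsRight⇒≡right (isRight _) = refl

≺-leaf : {p q : Pos leaf} → p ≺ q → ⊥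
≺-leaf ()

module _ {l r : Tree} where

  ≺-split : ∀ {u v : Pos (node l r)} → IsLeft u → IsRight v → u ≺ v
  ≺-split (isLeft _) (isRight _) = lr

  Br2<1-split : ∀ {u v w : Pos (node l r)} → IsLeft u → IsLeft v → IsRight w → Br2<1 u v w
  Br2<1-split (isLeft _) (isLeft _) (isRight _) = split

  Br1<2-split : ∀ {u v w : Pos (node l r)} → IsLeft u → IsRight v → IsRight w → Br1<2 u v w
  Br1<2-split (isLeft _) (isRight _) (isRight _) = split

  ≺-right-left : ∀ {u v : Pos (node l r)} → u ≺ v → IsRight u → IsLeft v → ⊥
  ≺-right-left lr () _
  ≺-right-left (ll _) () _
  ≺-right-left (rr _) _ ()

  Br2<1-left-right : ∀ {u v w : Pos (node l r)} → Br2<1 u v w → IsLeft u → IsRight v → ⊥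
  Br2<1-left-right split _ ()
  Br2<1-left-right (goL _) _ ()
  Br2<1-left-right (goR _) () _

  Br1<2-right-left : ∀ {u v w : Pos (node l r)} → Br1<2 u v w → IsRight v → IsLeft w → ⊥
  Br1<2-right-left split _ ()
  Br1<2-right-left (goL _) () _
  Br1<2-right-left (goR _) _ ()

restrict-nothing : ∀ {A} T {g : Pos T → Maybe A} → restrict T g ≡ nothing → ∀ p → g p ≡ nothing
restrict-nothing leaf {g} e here with g here
... | nothing = refl
restrict-nothing (node l r) {g} e p
  with restrict l (λ p → g (left p)) in eL | restrict r (λ p → g (right p)) in eR
restrict-nothing (node l r) e (left p)  | nothing | nothing = restrict-nothing l eL p
restrict-nothing (node l r) e (right p) | nothing | nothing = restrict-nothing r eR p
restrict-nothing (node l r) () p | nothing | just _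
restrict-nothing (node l r) () p | just _  | nothing
restrict-nothing (node l r) () p | just _  | just _

restrict-labelled : ∀ {A} T {g : Pos T → Maybe A} {S a} → restrict T g ≡ just S →
  a ∈ labels S → ∃ λ p → g p ≡ just a
restrict-labelled leaf {g} e a∈ with g here in eg
restrict-labelled leaf refl a∈ | just _ = here , trans eg (cong just (sym (singleton⁻ a∈)))
restrict-labelled (node l r) {g} e a∈
  with restrict l (λ p → g (left p)) in eL | restrict r (λ p → g (right p)) in eR
restrict-labelled (node l r) refl a∈ | just L | nothing
  with p , gp ← restrict-labelled l eL a∈ = left p , gp
restrict-labelled (node l r) refl a∈ | nothing | just R
  with p , gp ← restrict-labelled r eR a∈ = right p , gp
restrict-labelled (node l r) refl a∈ | just L | just R with ∈-++⁻ (labels L) a∈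
... | inj₁ a∈L with p , gp ← restrict-labelled l eL a∈L = left p , gp
... | inj₂ a∈R with p , gp ← restrict-labelled r eR a∈R = right p , gp

module _ {k : ℕ} where

  Var : Set
  Var = Fin k

  crossing : List Var → List Var → Conj k
  crossing xs ys =
    cartesianProductWith lt xs ys ++
    cartesianProductWith (λ (x , x′) y → lt21 x x′ y) (cartesianProduct xs xs) ys ++
    cartesianProductWith (λ x (y , y′) → lt12 x y y′) xs (cartesianProduct ys ys)

  brackets : LTree Var → Conj k
  brackets (lleaf _) = []
  brackets (lnode L R) = brackets L ++ brackets R ++ crossing (labels L) (labels R)

  module _ {xs ys : List Var} where

    crossing⁺ : {P : Bracket k → Set} →
      (∀ {x y} → x ∈ xs → y ∈ ys → P (lt x y)) →
      (∀ {x x′ y} → x ∈ xs → x′ ∈ xs → y ∈ ys → P (lt21 x x′ y)) →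
      (∀ {x y y′} → x ∈ xs → y ∈ ys → y′ ∈ ys → P (lt12 x y y′)) →
      All P (crossing xs ys)
    crossing⁺ {P} p₁ p₂₁ p₁₂ =
      ++⁺ (product⁺ lt xs ys p₁) (++⁺ (product⁺ _ (cartesianProduct xs xs) ys pairs₂₁)
                                      (product⁺ _ xs (cartesianProduct ys ys) pairs₁₂))
      where
        product⁺ = λ {A B : Set} → cartesianProductWith⁺ (setoid A) (setoid B) {P = P}
        pairs₂₁ : ∀ {xx′ y} → xx′ ∈ cartesianProduct xs xs → y ∈ ys → P (lt21 (proj₁ xx′) (proj₂ xx′) y)
        pairs₂₁ {x , x′} m y∈ with x∈ , x′∈ ← ∈-cartesianProduct⁻ xs xs m = p₂₁ x∈ x′∈ y∈
        pairs₁₂ : ∀ {x yy′} → x ∈ xs → yy′ ∈ cartesianProduct ys ys → P (lt12 x (proj₁ yy′) (proj₂ yy′))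
        pairs₁₂ {yy′ = y , y′} x∈ m with y∈ , y′∈ ← ∈-cartesianProduct⁻ ys ys m = p₁₂ x∈ y∈ y′∈

    lt∈crossing : ∀ {x y} → x ∈ xs → y ∈ ys → lt x y ∈ crossing xs ys
    lt∈crossing x∈ y∈ = ∈-++⁺ˡ (∈-cartesianProductWith⁺ lt x∈ y∈)

    lt21∈crossing : ∀ {x x′ y} → x ∈ xs → x′ ∈ xs → y ∈ ys → lt21 x x′ y ∈ crossing xs ys
    lt21∈crossing x∈ x′∈ y∈ = ∈-++⁺ʳ (cartesianProductWith lt xs ys)
      (∈-++⁺ˡ (∈-cartesianProductWith⁺ _ (∈-cartesianProduct⁺ x∈ x′∈) y∈))

    lt12∈crossing : ∀ {x y y′} → x ∈ xs → y ∈ ys → y′ ∈ ys → lt12 x y y′ ∈ crossing xs ys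
    lt12∈crossing x∈ y∈ y′∈ = ∈-++⁺ʳ (cartesianProductWith lt xs ys) (∈-++⁺ʳ _
      (∈-cartesianProductWith⁺ _ x∈ (∈-cartesianProduct⁺ y∈ y′∈)))

  VarsSatisfy : (Var → Set) → Bracket k → Set
  VarsSatisfy Q (lt a b) = Q a × Q b
  VarsSatisfy Q (lt21 a b c) = Q a × Q b × Q c
  VarsSatisfy Q (lt12 a b c) = Q a × Q b × Q c

  VarsSatisfy-map : {Q Q′ : Var → Set} → (∀ {a} → Q a → Q′ a) → ∀ {b} → VarsSatisfy Q b → VarsSatisfy Q′ b
  VarsSatisfy-map q {lt a b} (qa , qb) = q qa , q qb
  VarsSatisfy-map q {lt21 a b c} (qa , qb , qc) = q qa , q qb , q qc
  VarsSatisfy-map q {lt12 a b c} (qa , qb , qc) = q qa , q qb , q qc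

  brackets-vars : ∀ S → All (VarsSatisfy (_∈ labels S)) (brackets S)
  brackets-vars (lleaf _) = []
  brackets-vars (lnode L R) =
    ++⁺ (All.map (VarsSatisfy-map ∈ˡ) (brackets-vars L))
        (++⁺ (All.map (VarsSatisfy-map ∈ʳ) (brackets-vars R))
             (crossing⁺ (λ x y → ∈ˡ x , ∈ʳ y) (λ x x′ y → ∈ˡ x , ∈ˡ x′ , ∈ʳ y)
                        (λ x y y′ → ∈ˡ x , ∈ʳ y , ∈ʳ y′)))
    where
      ∈ˡ : ∀ {a} → a ∈ labels L → a ∈ labels L ++ labels R
      ∈ˡ = ∈-++⁺ˡ
      ∈ʳ : ∀ {a} → a ∈ labels R → a ∈ labels L ++ labels R
      ∈ʳ = ∈-++⁺ʳ (labels L)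

  HoldsAll-lnode : ∀ {T} {f : Var → Pos T} L R →
    HoldsAll f (brackets (lnode L R)) ⇔
    (HoldsAll f (brackets L) × HoldsAll f (brackets R) × HoldsAll f (crossing (labels L) (labels R)))
  HoldsAll-lnode L R = mk⇔
    (λ H → let (hL , H′) = ++⁻ (brackets L) H in hL , ++⁻ (brackets R) H′)
    (λ (hL , hR , hX) → ++⁺ hL (++⁺ hR hX))

  module _ {l r : Tree} {f : Var → Pos (node l r)} where

    Holds-left : ∀ b → VarsSatisfy (λ a → f a ≡ left (unLeft (f a))) b →
      Holds f b ⇔ Holds (unLeft ∘ f) b
    Holds-left (lt a b) (ea , eb) rewrite ea | eb = mk⇔ (λ { (ll x) → x }) ll
    Holds-left (lt21 a b c) (ea , eb , ec) rewrite ea | eb | ec = mk⇔ (λ { (goL x) → x }) goL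
    Holds-left (lt12 a b c) (ea , eb , ec) rewrite ea | eb | ec = mk⇔ (λ { (goL x) → x }) goL

    Holds-right : ∀ b → VarsSatisfy (λ a → f a ≡ right (unRight (f a))) b →
      Holds f b ⇔ Holds (unRight ∘ f) b
    Holds-right (lt a b) (ea , eb) rewrite ea | eb = mk⇔ (λ { (rr x) → x }) rr
    Holds-right (lt21 a b c) (ea , eb , ec) rewrite ea | eb | ec = mk⇔ (λ { (goR x) → x }) goR
    Holds-right (lt12 a b c) (ea , eb , ec) rewrite ea | eb | ec = mk⇔ (λ { (goR x) → x }) goR

    HoldsAll-left : ∀ S → (∀ {a} → a ∈ labels S → IsLeft (f a)) →
      HoldsAll f (brackets S) ⇔ HoldsAll (unLeft ∘ f) (brackets S)
    HoldsAll-left S goesLeft = All-⇔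
      (All.map (λ {b} vs → Holds-left b (VarsSatisfy-map (IsLeft⇒≡left ∘ goesLeft) vs)) (brackets-vars S))

    HoldsAll-right : ∀ S → (∀ {a} → a ∈ labels S → IsRight (f a)) →
      HoldsAll f (brackets S) ⇔ HoldsAll (unRight ∘ f) (brackets S)
    HoldsAll-right S goesRight = All-⇔
      (All.map (λ {b} vs → Holds-right b (VarsSatisfy-map (IsRight⇒≡right ∘ goesRight) vs)) (brackets-vars S))

    module _ {xs ys : List Var} where

      crossing-holds : (∀ {x} → x ∈ xs → IsLeft (f x)) → (∀ {y} → y ∈ ys → IsRight (f y)) →
        HoldsAll f (crossing xs ys)
      crossing-holds L R = crossing⁺ {xs} {ys} (λ x y → ≺-split (L x) (R y))
        (λ x x′ y → Br2<1-split (L x) (L x′) (R y)) (λ x y y′ → Br1<2-split (L x) (R y) (R y′))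

      -- x ∈ xs on the right is refuted by [u,x<y₀] or [x<u], and y ∈ ys on
      -- the left by [v<y] or [x₀<v,y].
      crossing-separates : HoldsAll f (crossing xs ys) → ∀ {x₀ y₀ u v} → x₀ ∈ xs → y₀ ∈ ys →
        u ∈ xs ++ ys → IsLeft (f u) → v ∈ xs ++ ys → IsRight (f v) →
        (∀ {x} → x ∈ xs → IsLeft (f x)) × (∀ {y} → y ∈ ys → IsRight (f y))
      crossing-separates H x₀∈ y₀∈ u∈ fu v∈ fv = goesLeft , goesRight
        where
          goesLeft : ∀ {x} → x ∈ xs → IsLeft (f x)
          goesLeft {x} x∈ with side (f x) | ∈-++⁻ xs u∈
          ... | inj₁ fx | _ = fx
          ... | inj₂ fx | inj₁ u∈xs = ⊥-elim (Br2<1-left-right (All.lookup H (lt21∈crossing {xs} {ys} u∈xs x∈ y₀∈)) fu fx)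
          ... | inj₂ fx | inj₂ u∈ys = ⊥-elim (≺-right-left (All.lookup H (lt∈crossing {xs} {ys} x∈ u∈ys)) fx fu)
          goesRight : ∀ {y} → y ∈ ys → IsRight (f y)
          goesRight {y} y∈ with side (f y) | ∈-++⁻ xs v∈
          ... | inj₂ fy | _ = fy
          ... | inj₁ fy | inj₁ v∈xs = ⊥-elim (≺-right-left (All.lookup H (lt∈crossing {xs} {ys} v∈xs y∈)) fv fy)
          ... | inj₁ fy | inj₂ v∈ys = ⊥-elim (Br1<2-right-left (All.lookup H (lt12∈crossing {xs} {ys} x₀∈ v∈ys y∈)) fv fy)

  record PartialInverse (T : Tree) (g : Pos T → Maybe Var) (f : Var → Pos T) (xs : List Var) : Set where
    field
      labelled⇒placed : ∀ {p a} → g p ≡ just a → a ∈ xs × f a ≡ p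
      placed⇒labelled : ∀ {a} → a ∈ xs → g (f a) ≡ just a
  open PartialInverse

  module _ {l r : Tree} {g : Pos (node l r) → Maybe Var} {f : Var → Pos (node l r)} {xs : List Var}
           (inv : PartialInverse (node l r) g f xs) where

    PartialInverse-left : ∀ {ys} → ys ⊆ xs → (∀ {a} → a ∈ ys → IsLeft (f a)) →
      (∀ {a} → a ∈ xs → IsLeft (f a) → a ∈ ys) →
      PartialInverse l (λ p → g (left p)) (unLeft ∘ f) ys
    PartialInverse-left ys⊆xs goesLeft onlyYs = record
      { labelled⇒placed = λ {p} gp → let (a∈ , fa) = labelled⇒placed inv gp in
          onlyYs a∈ (subst IsLeft (sym fa) (isLeft p)) , cong unLeft fa
      ; placed⇒labelled = λ {a} a∈ →
          subst (λ q → g q ≡ just a) (IsLeft⇒≡left (goesLeft a∈)) (placed⇒labelled inv (ys⊆xs a∈))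
      }

    PartialInverse-right : ∀ {ys} → ys ⊆ xs → (∀ {a} → a ∈ ys → IsRight (f a)) →
      (∀ {a} → a ∈ xs → IsRight (f a) → a ∈ ys) →
      PartialInverse r (λ p → g (right p)) (unRight ∘ f) ys
    PartialInverse-right ys⊆xs goesRight onlyYs = record
      { labelled⇒placed = λ {p} gp → let (a∈ , fa) = labelled⇒placed inv gp in
          onlyYs a∈ (subst IsRight (sym fa) (isRight p)) , cong unRight fa
      ; placed⇒labelled = λ {a} a∈ →
          subst (λ q → g q ≡ just a) (IsRight⇒≡right (goesRight a∈)) (placed⇒labelled inv (ys⊆xs a∈))
      }

    labelled-at : ∀ {a p} → a ∈ xs → f a ≡ p → g p ≡ just a
    labelled-at {a} a∈ fa = subst (λ q → g q ≡ just a) fa (placed⇒labelled inv a∈)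

    restrict-left-nothing : restrict l (λ p → g (left p)) ≡ nothing → ∀ {a} → a ∈ xs → IsRight (f a)
    restrict-left-nothing e {a} a∈ with f a in fa
    ... | right p = isRight p
    ... | left p with () ← trans (sym (labelled-at a∈ fa)) (restrict-nothing l e p)

    restrict-right-nothing : restrict r (λ p → g (right p)) ≡ nothing → ∀ {a} → a ∈ xs → IsLeft (f a)
    restrict-right-nothing e {a} a∈ with f a in fa
    ... | left p = isLeft p
    ... | right p with () ← trans (sym (labelled-at a∈ fa)) (restrict-nothing r e p)

    restrict-left-labels : ∀ {L a} → restrict l (λ p → g (left p)) ≡ just L → a ∈ labels L →
      a ∈ xs × IsLeft (f a)
    restrict-left-labels e a∈ with p , gp ← restrict-labelled l e a∈
      with a∈xs , fa ← labelled⇒placed inv gp = a∈xs , subst IsLeft (sym fa) (isLeft p)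

    restrict-right-labels : ∀ {R a} → restrict r (λ p → g (right p)) ≡ just R → a ∈ labels R →
      a ∈ xs × IsRight (f a)
    restrict-right-labels e a∈ with p , gp ← restrict-labelled r e a∈
      with a∈xs , fa ← labelled⇒placed inv gp = a∈xs , subst IsRight (sym fa) (isRight p)

  PartialInverse-split : ∀ {l r g f} A B → PartialInverse (node l r) g f (labels A ++ labels B) →
    (∀ {a} → a ∈ labels A → IsLeft (f a)) → (∀ {b} → b ∈ labels B → IsRight (f b)) →
    PartialInverse l (λ p → g (left p)) (unLeft ∘ f) (labels A) ×
    PartialInverse r (λ p → g (right p)) (unRight ∘ f) (labels B)
  PartialInverse-split A B inv goesLeft goesRight =
    PartialInverse-left inv ∈-++⁺ˡ goesLeft onlyA , PartialInverse-right inv (∈-++⁺ʳ (labels A)) goesRight onlyB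
    where
      onlyA : ∀ {a} → a ∈ labels A ++ labels B → IsLeft _ → a ∈ labels A
      onlyA a∈ fa with ∈-++⁻ (labels A) a∈
      ... | inj₁ a∈A = a∈A
      ... | inj₂ a∈B = ⊥-elim (IsLeft∧IsRight⇒⊥ fa (goesRight a∈B))
      onlyB : ∀ {b} → b ∈ labels A ++ labels B → IsRight _ → b ∈ labels B
      onlyB b∈ fb with ∈-++⁻ (labels A) b∈
      ... | inj₂ b∈B = b∈B
      ... | inj₁ b∈A = ⊥-elim (IsLeft∧IsRight⇒⊥ (goesLeft b∈A) fb)

  RestrictionCharacterised : Tree → Set
  RestrictionCharacterised T = ∀ g f S → PartialInverse T g f (labels S) →
    restrict T g ≡ just S ⇔ HoldsAll f (brackets S)

  module _ {l r : Tree} {g : Pos (node l r) → Maybe Var} {f : Var → Pos (node l r)}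
           (ihˡ : RestrictionCharacterised l) (ihʳ : RestrictionCharacterised r) where

    restrict-split-⇒ : ∀ L R → PartialInverse (node l r) g f (labels (lnode L R)) →
      restrict l (λ p → g (left p)) ≡ just L → restrict r (λ p → g (right p)) ≡ just R →
      HoldsAll f (brackets (lnode L R))
    restrict-split-⇒ L R inv eL eR = from (HoldsAll-lnode L R)
      ( from (HoldsAll-left L goesLeft) (to (ihˡ _ _ L invL) eL)
      , from (HoldsAll-right R goesRight) (to (ihʳ _ _ R invR) eR)
      , crossing-holds goesLeft goesRight )
      where
        goesLeft : ∀ {a} → a ∈ labels L → IsLeft (f a)
        goesLeft a∈ = proj₂ (restrict-left-labels inv eL a∈)
        goesRight : ∀ {a} → a ∈ labels R → IsRight (f a)
        goesRight a∈ = proj₂ (restrict-right-labels inv eR a∈)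
        invL = proj₁ (PartialInverse-split L R inv goesLeft goesRight)
        invR = proj₂ (PartialInverse-split L R inv goesLeft goesRight)

    restrict-split-⇐ : ∀ L R S → PartialInverse (node l r) g f (labels S) →
      restrict l (λ p → g (left p)) ≡ just L → restrict r (λ p → g (right p)) ≡ just R →
      HoldsAll f (brackets S) → lnode L R ≡ S
    restrict-split-⇐ L R (lleaf a) inv eL eR _
      with u∈ , fu ← restrict-left-labels inv eL (leftmost∈labels L)
         | v∈ , fv ← restrict-right-labels inv eR (leftmost∈labels R)
      rewrite singleton⁻ u∈ | singleton⁻ v∈ = ⊥-elim (IsLeft∧IsRight⇒⊥ fu fv)
    restrict-split-⇐ L R (lnode A B) inv eL eR H =
      cong₂ lnode (just-injective (trans (sym eL) eA)) (just-injective (trans (sym eR) eB))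
      where
        hA = proj₁ (to (HoldsAll-lnode A B) H)
        hB = proj₁ (proj₂ (to (HoldsAll-lnode A B) H))
        hX = proj₂ (proj₂ (to (HoldsAll-lnode A B) H))
        u = restrict-left-labels inv eL (leftmost∈labels L)
        v = restrict-right-labels inv eR (leftmost∈labels R)
        separated = crossing-separates hX (leftmost∈labels A) (leftmost∈labels B)
          (proj₁ u) (proj₂ u) (proj₁ v) (proj₂ v)
        invA = proj₁ (PartialInverse-split A B inv (proj₁ separated) (proj₂ separated))
        invB = proj₂ (PartialInverse-split A B inv (proj₁ separated) (proj₂ separated))
        eA = from (ihˡ _ _ A invA) (to (HoldsAll-left A (proj₁ separated)) hA)
        eB = from (ihʳ _ _ B invB) (to (HoldsAll-right B (proj₂ separated)) hB)

  restrict-characterised : ∀ T → RestrictionCharacterised T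
  restrict-characterised leaf g f (lleaf a) inv = mk⇔ (λ _ → [])
    (λ _ → cong (Maybe.map lleaf) (subst (λ p → g p ≡ just a) (leaf-pos (f a)) (placed⇒labelled inv (here refl))))
  restrict-characterised leaf g f (lnode A B) inv = mk⇔ (λ e → ⊥-elim (map-lleaf≢lnode e))
    (λ H → ⊥-elim (≺-leaf (All.lookup (proj₂ (proj₂ (to (HoldsAll-lnode A B) H)))
                                       (lt∈crossing (leftmost∈labels A) (leftmost∈labels B)))))
    where
      map-lleaf≢lnode : Maybe.map lleaf (g here) ≡ just (lnode A B) → ⊥
      map-lleaf≢lnode e with g here
      map-lleaf≢lnode () | just _
  restrict-characterised (node l r) g f S inv
    with restrict l (λ p → g (left p)) in eL | restrict r (λ p → g (right p)) in eR
  ... | nothing | nothing = ⊥-elim (IsLeft∧IsRight⇒⊥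
          (restrict-right-nothing inv eR (leftmost∈labels S)) (restrict-left-nothing inv eL (leftmost∈labels S)))
  ... | nothing | just R =
    ⇔-sym (HoldsAll-right S goesRight) ⇔-∘ subst (λ m → m ≡ just S ⇔ _) eR (restrict-characterised r _ _ S invR)
    where
      goesRight = restrict-left-nothing inv eL
      invR = PartialInverse-right inv id goesRight (λ a∈ _ → a∈)
  ... | just L | nothing =
    ⇔-sym (HoldsAll-left S goesLeft) ⇔-∘ subst (λ m → m ≡ just S ⇔ _) eL (restrict-characterised l _ _ S invL)
    where
      goesLeft = restrict-right-nothing inv eR
      invL = PartialInverse-left inv id goesLeft (λ a∈ _ → a∈)
  ... | just L | just R = mk⇔ (λ { refl → restrict-split-⇒ ihˡ ihʳ L R inv eL eR })
                              (cong just ∘ restrict-split-⇐ ihˡ ihʳ L R S inv eL eR)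
    where
      ihˡ = restrict-characterised l
      ihʳ = restrict-characterised r

assigned-sound : ∀ {k T} (f : Fin k → Pos T) {p a} → assigned f p ≡ just a → f a ≡ p
assigned-sound {suc k} f {p} e with f zero ≟P p
assigned-sound {suc k} f refl | yes f0≡p = f0≡p
assigned-sound {suc k} f {p} e | no _ with assigned (f ∘ suc) p in e′
assigned-sound {suc k} f refl | no _ | just i = assigned-sound (f ∘ suc) e′

assigned-complete : ∀ {k T} (f : Fin k → Pos T) → Injective _≡_ _≡_ f → ∀ a → assigned f (f a) ≡ just a
assigned-complete {suc k} f inj zero with f zero ≟P f zero
... | yes _ = refl
... | no f0≢f0 = ⊥-elim (f0≢f0 refl)
assigned-complete {suc k} f inj (suc i) with f zero ≟P f (suc i)
... | yes f0≡fi with () ← inj f0≡fi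
... | no _ rewrite assigned-complete (f ∘ suc) (suc-injective ∘ inj) i = refl

claim1 : (k : ℕ) (P : Pattern k) →
    Σ (Conj k) (λ C → (T : Tree) (f : Fin k → Pos T) → Injective _≡_ _≡_ f →
    (Matches T f P ⇔ HoldsAll f C))
claim1 k P = brackets (shape P) , λ T f inj →
  restrict-characterised T (assigned f) f (shape P) record
    { labelled⇒placed = λ e → covers P _ , assigned-sound f e
    ; placed⇒labelled = λ {a} _ → assigned-complete f inj a
    }
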